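{- If $\mathcal U$ is a Ramseyan ultrafilter, then $\{\mathrm{Min}(X)\setminus\{0\}: X\in\mathcal U\}$ is a Ramsey ultrafilter over $\omega\setminus\{0\}$.
   Context: A partition of a set $S$ is a set of pairwise disjoint nonempty subsets (blocks) with union $S$. $(\omega)$ is the set of all partitions of $\omega$, $(\omega)^\omega$ those with infinitely many blocks, $\{\omega\}$ the one-block partition. For partitions $X,Y$ of the same set, $X\sqsubseteq Y$ means every block of $X$ is a union of blocks of $Y$; $X\sqcap Y$ is the finest partition coarser than both. A partition-filter is $\mathcal F\subseteq(\omega)$ with (a) $\{\omega\}\notin\mathcal F$; (b) $X,Y\in\mathcal F\Rightarrow X\sqcap Y\in\mathcal F$; (c) $X\in\mathcal F$, $X\sqsubseteq Y\in(\omega)$ $\Rightarrow Y\in\mathcal F$. A partition-ultrafilter is a partition-filter not properly contained in any partition-filter. A segment is a partition $s$ of a natural number $n=\{0,\dots,n-1\}$; $\mathrm{dom}(s)=n$, $|s|$ = number of blocks, $s^*:=s\cup\{\{\mathrm{dom}(s)\}\}$. For a segment $s$ and a partition $X$ of $\omega$ (or a segment $X$ with larger domain): $s\sqsubseteq X$ means each block of $s$ is a union of sets $b\cap\mathrm{dom}(s)$, $b\in X$; $s\trianglelefteq X$ means each block of $s$ equals $d\cap\mathrm{dom}(s)$ for some $d\in X$. $(\omega)^{(m)}$ is the set of segments with $m$ blocks and $(s,X)^{(m)}:=\{u\text{ segment}:|u|=m,\ s\trianglelefteq u,\ u^*\sqsubseteq X\}$. A family $\mathcal C\subseteq(\omega)^\omega$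 has the segment-coloring-property if for all $r,k\in\omega$, every function $\pi:\bigcup_{n\in\omega}(\omega)^{(n+k+1)}\to\{0,\dots,r\}$ and every $Z\in\mathcal C$ there is $X\in\mathcal C$ with $X\sqsubseteq Z$ such that for every $n$ and every segment $s\trianglelefteq X$ with $|s|=n+1$, $\pi$ is constant on $(s,X)^{(n+k+1)}$. A Ramseyan ultrafilter is a partition-ultrafilter $\mathcal U\subseteq(\omega)^\omega$ with the segment-coloring-property. For a set $P$ of nonempty subsets of $\omega$, $\mathrm{Min}(P):=\{\min b: b\in P\}$. A Ramsey ultrafilter over an infinite set $A\subseteq\omega$ is a non-principal ultrafilter $\mathcal V$ on $A$ such that for all positive integers $n,r$ and every coloring $[A]^n\to r$ of the $n$-element subsets of $A$, there is $H\in\mathcal V$ with $[H]^n$ monochromatic. -}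

module Defs where

open import Level using (Level; 0ℓ) renaming (suc to lsuc)
open import Data.Nat using (ℕ; zero; suc; _+_; _≤_; _<_; _≤ᵇ_; _≡ᵇ_; _≟_)
open import Data.Bool using (Bool; true; false; _∧_; T)
open import Data.Fin using (Fin)
open import Data.List using (List; []; _∷_; length; _++_; [_]; filter; upTo; foldr)
open import Data.Vec using (Vec; []; _∷_)
open import Data.Vec.Relation.Unary.All using (All)
open import Data.Product using (Σ; _×_; _,_; ∃)
open import Data.Sum using (_⊎_)
open import Data.Unit using (⊤)
open import Data.Empty using (⊥)
open import Relation.Nullary using (¬_)
open import Relation.Binary.PropositionalEquality using (_≡_)
open import Relation.Binary using (IsEquivalence)

Subset : Set₁
Subset = ℕ → Set

_⊆_ : Subset → Subset → Set
B ⊆ C = ∀ n → B n → C n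

_∩_ : Subset → Subset → Subset
(B ∩ C) n = B n × C n

_∖_ : Subset → Subset → Subset
(B ∖ C) n = B n × ¬ C n

∅ : Subset
∅ _ = ⊥

-- ω ∖ {0}  (written as {n | 0 < n}, whose membership proofs are unique)
ω∖0 : Subset
ω∖0 n = 0 < n

record Partition : Set₁ where
  field
    _∼_     : ℕ → ℕ → Set
    isEquiv : IsEquivalence _∼_
open Partition public

-- X ⊑ Y : every block of X is a union of blocks of Y (X is coarser),
-- i.e. every block of Y is contained in a block of X.
_⊑_ : Partition → Partition → Set
X ⊑ Y = ∀ i j → _∼_ Y i j → _∼_ X i j

oneBlock : Partition
oneBlock = record { _∼_ = λ _ _ → ⊤ ; isEquiv = record { refl = _ ; sym = λ _ → _ ; trans = λ _ _ → _ } }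

-- X ⊓ Y : the finest partition coarser than both X and Y
-- (equivalence relation generated by the union of the two relations).
data Join (X Y : Partition) : ℕ → ℕ → Set where
  inl   : ∀ {i j} → _∼_ X i j → Join X Y i j
  inr   : ∀ {i j} → _∼_ Y i j → Join X Y i j
  trans : ∀ {i j k} → Join X Y i j → Join X Y j k → Join X Y i k

private
  joinSym : ∀ {X Y i j} → Join X Y i j → Join X Y j i
  joinSym {X} (inl p) = inl (IsEquivalence.sym (isEquiv X) p)
  joinSym {Y = Y} (inr p) = inr (IsEquivalence.sym (isEquiv Y) p)
  joinSym (trans p q) = trans (joinSym q) (joinSym p)

_⊓_ : Partition → Partition → Partition
X ⊓ Y = record
  { _∼_ = Join X Y
  ; isEquiv = record { refl = inl (IsEquivalence.refl (isEquiv X)) ; sym = joinSym ; trans = trans } }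

InfinitelyManyBlocks : Partition → Set
InfinitelyManyBlocks X =
  ∀ n → Σ (Fin n → ℕ) λ f → ∀ a b → _∼_ X (f a) (f b) → a ≡ b

Min : Partition → Subset
Min X n = ∀ m → m < n → ¬ (_∼_ X m n)

record IsPartitionFilter (F : Partition → Set) : Set₁ where
  field
    notOne  : ¬ F oneBlock
    meet    : ∀ X Y → F X → F Y → F (X ⊓ Y)
    upward  : ∀ X Y → F X → X ⊑ Y → F Y

record IsPartitionUltrafilter (U : Partition → Set) : Set₂ where
  field
    isFilter : IsPartitionFilter U
    maximal  : ∀ (F : Partition → Set) → IsPartitionFilter F →
               (∀ X → U X → F X) → ∀ X → F X → U X

-- Segments: a partition s of n = {0,…,n-1} is encoded canonically by
-- the list  mins  of length n whose i-th entry is the least element of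
-- the block of i.

_!_ : List ℕ → ℕ → ℕ
[] ! _ = 0
(x ∷ xs) ! zero = x
(x ∷ xs) ! suc i = xs ! i

validᵇ : List ℕ → Bool
validᵇ l = foldr (λ i b → ((l ! i) ≤ᵇ i) ∧ ((l ! (l ! i)) ≡ᵇ (l ! i)) ∧ b) true (upTo (length l))

record Segment : Set where
  constructor seg
  field
    mins  : List ℕ
    valid : T (validᵇ mins)
open Segment public

dom : Segment → ℕ
dom s = length (mins s)

LRel : List ℕ → ℕ → ℕ → Set
LRel l i j = i < length l × j < length l × l ! i ≡ l ! j

SRel : Segment → ℕ → ℕ → Set
SRel s = LRel (mins s)

-- |s| : number of blocks (= number of block minima)
∣_∣ : Segment → ℕ
∣ s ∣ = length (filter (λ i → mins s ! i ≟ i) (upTo (dom s)))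

star : Segment → List ℕ
star s = mins s ++ [ dom s ]

_⊑ᴸ_ : List ℕ → Partition → Set
l ⊑ᴸ X = ∀ i j → i < length l → j < length l → _∼_ X i j → LRel l i j

_⊴_ : Segment → Partition → Set
s ⊴ X = ∀ i j → i < dom s → j < dom s → (SRel s i j → _∼_ X i j) × (_∼_ X i j → SRel s i j)

_⊴ˢ_ : Segment → Segment → Set
s ⊴ˢ u = dom s ≤ dom u ×
  (∀ i j → i < dom s → j < dom s → (SRel s i j → SRel u i j) × (SRel u i j → SRel s i j))

InSX : Segment → Partition → ℕ → Segment → Set
InSX s X m u = ∣ u ∣ ≡ m × s ⊴ˢ u × star u ⊑ᴸ X

SegmentColoringProperty : (Partition → Set) → Set₁
SegmentColoringProperty C =
  ∀ (r k : ℕ) (π : (u : Segment) → suc k ≤ ∣ u ∣ → Fin (suc r)) (Z : Partition) → C Z →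
  Σ Partition λ X → C X × X ⊑ Z ×
    (∀ n (s : Segment) → s ⊴ X → ∣ s ∣ ≡ suc n →
      ∀ u u' (p : suc k ≤ ∣ u ∣) (p' : suc k ≤ ∣ u' ∣) →
      InSX s X (n + suc k) u → InSX s X (n + suc k) u' → π u p ≡ π u' p')

record IsRamseyanUltrafilter (U : Partition → Set) : Set₂ where
  field
    infinite    : ∀ X → U X → InfinitelyManyBlocks X
    ultrafilter : IsPartitionUltrafilter U
    coloring    : SegmentColoringProperty U

-- strictly increasing tuples code n-element subsets
Increasing : ∀ {n} → Vec ℕ n → Set
Increasing [] = ⊤
Increasing (x ∷ []) = ⊤
Increasing (x ∷ y ∷ v) = x < y × Increasing (y ∷ v)

record IsRamseyUltrafilterOver {ℓ : Level} (A : Subset) (V : Subset → Set ℓ) : Set (lsuc 0ℓ Level.⊔ ℓ) where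
  field
    subsets   : ∀ B → V B → B ⊆ A
    whole     : V A
    proper    : ¬ V ∅
    inter     : ∀ B C → V B → V C → V (B ∩ C)
    upward    : ∀ B C → V B → B ⊆ C → C ⊆ A → V C
    ultra     : ∀ B → B ⊆ A → V B ⊎ V (A ∖ B)
    nonPrincipal : ¬ (Σ ℕ λ a → A a × (∀ B → B ⊆ A → (V B → B a) × (B a → V B)))
    ramsey    : ∀ (n r : ℕ) → 0 < n → 0 < r →
                (c : (v : Vec ℕ n) → Increasing v → All A v → Fin r) →
                Σ Subset λ H → V H × Σ (Fin r) λ colour →
                  ∀ v (p : Increasing v) (q : All A v) → All H v → c v p q ≡ colour

-- { Min(X) ∖ {0} : X ∈ U }, membership up to extensional equality of sets
MinImage : (Partition → Set) → Subset → Set₁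
MinImage U B = Σ Partition λ X → U X × (B ⊆ (Min X ∖ (λ n → n ≡ 0))) × ((Min X ∖ (λ n → n ≡ 0)) ⊆ B)

-- For X ∈ U, every B with Min X ∖ {0} ⊆ B ⊆ ω ∖ {0} is Min Y ∖ {0} for the refinement Y of X
-- that cuts each block of X at its points in B. As coarser partitions have fewer block minima
-- and the discrete partition lies in U, this gives the filter axioms; and since the partitions
-- in U have infinitely many blocks, Min X ∖ {0} is never inside a singleton.
-- An increasing tuple x₁ < ⋯ < xₖ₊₁ from Min X ∖ {0} is coded by the coarsening of X to the
-- segment of domain xₖ₊₁ with block minima 0, x₁, …, xₖ, which lies in ({{0}}, X)^(k+1).
-- Colouring each segment by the tuple it codes, the segment-colouring property gives X ∈ U
-- for which Min X ∖ {0} is homogeneous. The ultrafilter property is the case of singletons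
-- and two colours.

module Submission where

open import Level using (0ℓ; _⊔_; Lift; lift; lower) renaming (suc to lsuc)
open import Axiom.ExcludedMiddle using (ExcludedMiddle)
open import Function using (id; _∘_; _on_)
open import Function.Bundles using (Equivalence)
open import Data.Bool using (T; true; _∧_)
open import Data.Bool.Properties using (T-∧)
open import Data.Nat using (ℕ; zero; suc; _≤_; _<_; _≤ᵇ_; _≡ᵇ_; _≟_; z≤n; s≤s)
open import Data.Nat.Properties
  using (≤-refl; ≤-trans; ≤-antisym; ≤-reflexive; ≤-pred; <⇒≤; >⇒≢; <⇒≱; <-asym; ≮⇒≥;
         m≤n⇒m≤1+n; m≤n⇒m<n∨m≡n; m<1+n⇒m<n∨m≡n; n≢0⇒n>0; suc-injective; +-comm;
         <-trans; <-irrelevant; ≤⇒≤ᵇ; ≡⇒≡ᵇ)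
open import Data.Nat.Induction using (<-rec)
open import Data.Fin using (Fin; zero; suc)
import Data.Fin.Properties as Fin
open import Data.List using (List; []; _∷_; _++_; _∷ʳ_; length; filter; upTo; applyUpTo; foldr)
open import Data.List.Properties using (length-applyUpTo; length-++)
open import Data.List.Membership.Propositional using (_∈_)
open import Data.List.Membership.Propositional.Properties using (∈-filter⁺; ∈-filter⁻; ∈-upTo⁺; ∈-upTo⁻)
open import Data.List.Relation.Unary.Any using (here; there)
import Data.List.Relation.Unary.All as L
import Data.List.Relation.Unary.All.Properties as Lₚ
open import Data.List.Relation.Unary.AllPairs using (AllPairs; []; _∷_)
import Data.List.Relation.Unary.AllPairs.Properties as AllPairs
open import Data.List.Relation.Unary.Linked using (Linked; []; [-]; _∷_)
open import Data.List.Relation.Unary.Linked.Properties using (Linked⇒AllPairs)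
open import Data.Vec using (Vec; []; _∷_; toList; initLast; lookup)
open import Data.Vec.Properties using (toList-injective; toList-∷ʳ; length-toList; ∷-injectiveʳ)
open import Data.Vec.Relation.Binary.Equality.Cast using (cast-is-id)
open import Data.Vec.Relation.Unary.All using (All; []; _∷_)
import Data.Vec.Relation.Unary.All as V
import Data.Vec.Relation.Unary.All.Properties as Vₚ
open import Data.Product using (Σ; ∃; _×_; _,_; proj₁; proj₂)
open import Data.Sum using (_⊎_; inj₁; inj₂)
open import Data.Unit using (tt)
open import Data.Empty using (⊥-elim)
open import Relation.Nullary using (Dec; yes; no; ¬_; contradiction)
open import Relation.Nullary.Decidable using (map′)
open import Relation.Binary using (IsEquivalence)
import Relation.Binary.Construct.On as On
open import Relation.Binary.PropositionalEquality
  using (_≡_; refl; sym; trans; cong; cong₂; subst; isEquivalence; module ≡-Reasoning)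
open import Defs renaming (trans to ⊓-trans)

lower-em : ∀ {a} b → ExcludedMiddle (a ⊔ b) → ExcludedMiddle a
lower-em b em = map′ lower lift (em {Lift b _})

greatest-≤ : {P : ℕ → Set} → (∀ m → Dec (P m)) → ∀ {m} n → m ≤ n → P m →
             Σ ℕ λ g → g ≤ n × P g × (∀ {m′} → m′ ≤ n → P m′ → m′ ≤ g)
greatest-≤ P? zero z≤n Pm = zero , z≤n , Pm , λ { z≤n _ → z≤n }
greatest-≤ {P} P? (suc n) m≤1+n Pm with P? (suc n)
... | yes P[1+n] = suc n , ≤-refl , P[1+n] , λ m′≤1+n _ → m′≤1+n
... | no ¬P[1+n] =
  let g , g≤n , Pg , maximal = greatest-≤ P? n (≤n m≤1+n Pm) Pm
  in g , m≤n⇒m≤1+n g≤n , Pg , λ m′≤1+n Pm′ → maximal (≤n m′≤1+n Pm′) Pm′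
  where
  ≤n : ∀ {m} → m ≤ suc n → P m → m ≤ n
  ≤n m≤1+n Pm with m≤n⇒m<n∨m≡n m≤1+n
  ... | inj₁ m<1+n = ≤-pred m<1+n
  ... | inj₂ refl = contradiction Pm ¬P[1+n]

length-∷ʳ : ∀ {A : Set} (xs : List A) x → length (xs ∷ʳ x) ≡ suc (length xs)
length-∷ʳ xs x = trans (length-++ xs) (+-comm (length xs) 1)

!-++ˡ : ∀ (xs ys : List ℕ) {i} → i < length xs → (xs ++ ys) ! i ≡ xs ! i
!-++ˡ (x ∷ xs) ys {zero} _ = refl
!-++ˡ (x ∷ xs) ys {suc i} i<len = !-++ˡ xs ys (≤-pred i<len)

!-applyUpTo : ∀ (f : ℕ → ℕ) {n i} → i < n → applyUpTo f n ! i ≡ f i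
!-applyUpTo f {suc n} {zero} _ = refl
!-applyUpTo f {suc n} {suc i} i<n = !-applyUpTo (f ∘ suc) (≤-pred i<n)

AllPairs-∷ʳ⁻ : ∀ {A : Set} {R : A → A → Set} {xs y} →
               AllPairs R (xs ∷ʳ y) → AllPairs R xs × L.All (λ x → R x y) xs
AllPairs-∷ʳ⁻ {xs = []} _ = [] , L.[]
AllPairs-∷ʳ⁻ {xs = x ∷ xs} (x<xs∷ʳy ∷ sorted) =
  let sorted-xs , xs<y = AllPairs-∷ʳ⁻ sorted
      x<xs , x<[y] = Lₚ.++⁻ xs x<xs∷ʳy
  in (x<xs ∷ sorted-xs) , (L.head x<[y] L.∷ xs<y)

AllPairs-<-unique : ∀ {xs ys} → AllPairs _<_ xs → AllPairs _<_ ys →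
                    (∀ {z} → z ∈ xs → z ∈ ys) → (∀ {z} → z ∈ ys → z ∈ xs) → xs ≡ ys
AllPairs-<-unique {[]} {[]} _ _ _ _ = refl
AllPairs-<-unique {[]} {_ ∷ _} _ _ _ ys⊆xs with () ← ys⊆xs (here refl)
AllPairs-<-unique {_ ∷ _} {[]} _ _ xs⊆ys _ with () ← xs⊆ys (here refl)
AllPairs-<-unique {x ∷ xs} {y ∷ ys} (x<xs ∷ sorted-xs) (y<ys ∷ sorted-ys) xs⊆ys ys⊆xs =
  cong₂ _∷_ x≡y (AllPairs-<-unique sorted-xs sorted-ys
                   (tail⊆ x<xs x≡y (xs⊆ys ∘ there)) (tail⊆ y<ys (sym x≡y) (ys⊆xs ∘ there)))
  where
  heads≡ : ∀ {x y xs ys} → L.All (x <_) xs → L.All (y <_) ys → x ∈ y ∷ ys → y ∈ x ∷ xs → x ≡ y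
  heads≡ _ _ (here x≡y) _ = x≡y
  heads≡ _ _ (there _) (here y≡x) = sym y≡x
  heads≡ x<xs y<ys (there x∈ys) (there y∈xs) = contradiction (L.lookup y<ys x∈ys) (<-asym (L.lookup x<xs y∈xs))

  x≡y : x ≡ y
  x≡y = heads≡ x<xs y<ys (xs⊆ys (here refl)) (ys⊆xs (here refl))

  tail⊆ : ∀ {x y xs ys} → L.All (x <_) xs → x ≡ y → (∀ {z} → z ∈ xs → z ∈ y ∷ ys) → ∀ {z} → z ∈ xs → z ∈ ys
  tail⊆ x<xs x≡y xs⊆ z∈xs with xs⊆ z∈xs
  ... | here z≡y = contradiction (trans z≡y (sym x≡y)) (>⇒≢ (L.lookup x<xs z∈xs))
  ... | there z∈ys = z∈ys

Increasing⇒Linked : ∀ {n} {v : Vec ℕ n} → Increasing v → Linked _<_ (toList v)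
Increasing⇒Linked {v = []} _ = []
Increasing⇒Linked {v = _ ∷ []} _ = [-]
Increasing⇒Linked {v = _ ∷ _ ∷ _} (x<y , increasing) = x<y ∷ Increasing⇒Linked increasing

Increasing-irrelevant : ∀ {n} {v : Vec ℕ n} (p q : Increasing v) → p ≡ q
Increasing-irrelevant {v = []} _ _ = refl
Increasing-irrelevant {v = _ ∷ []} _ _ = refl
Increasing-irrelevant {v = _ ∷ _ ∷ _} (x<y , p) (x<y′ , q) =
  cong₂ _,_ (<-irrelevant x<y x<y′) (Increasing-irrelevant p q)

∼-refl : ∀ X {i} → _∼_ X i i
∼-refl X = IsEquivalence.refl (isEquiv X)

∼-sym : ∀ X {i j} → _∼_ X i j → _∼_ X j i
∼-sym X = IsEquivalence.sym (isEquiv X)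

∼-trans : ∀ X {i j k} → _∼_ X i j → _∼_ X j k → _∼_ X i k
∼-trans X = IsEquivalence.trans (isEquiv X)

Join-elim : ∀ {X Y} {R : ℕ → ℕ → Set} → (∀ {i j} → _∼_ X i j → R i j) → (∀ {i j} → _∼_ Y i j → R i j) →
            (∀ {i j k} → R i j → R j k → R i k) → ∀ {i j} → Join X Y i j → R i j
Join-elim fromX fromY _ (inl i∼j) = fromX i∼j
Join-elim fromX fromY _ (inr i∼j) = fromY i∼j
Join-elim fromX fromY R-trans (⊓-trans i∼j j∼k) =
  R-trans (Join-elim fromX fromY R-trans i∼j) (Join-elim fromX fromY R-trans j∼k)

⊓-⊑ˡ : ∀ X Y → (X ⊓ Y) ⊑ X
⊓-⊑ˡ X Y _ _ = inl

⊓-⊑ʳ : ∀ X Y → (X ⊓ Y) ⊑ Y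
⊓-⊑ʳ X Y _ _ = inr

⊑⇒Min⊆ : ∀ X Y → X ⊑ Y → Min X ⊆ Min Y
⊑⇒Min⊆ X Y X⊑Y n minX m m<n m∼n = minX m m<n (X⊑Y m n m∼n)

kernel : (ℕ → ℕ) → Partition
kernel f = record { _∼_ = _≡_ on f ; isEquiv = On.isEquivalence f isEquivalence }

discrete : Partition
discrete = kernel id

⊓-discreteʳ : ∀ X Y → discrete ⊑ Y → X ⊑ (X ⊓ Y)
⊓-discreteʳ X Y Y-discrete _ _ =
  Join-elim id (λ i∼j → IsEquivalence.reflexive (isEquiv X) (Y-discrete _ _ i∼j)) (∼-trans X)

⊓-discreteˡ : ∀ X Y → discrete ⊑ X → Y ⊑ (X ⊓ Y)
⊓-discreteˡ X Y X-discrete _ _ =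
  Join-elim (λ i∼j → IsEquivalence.reflexive (isEquiv Y) (X-discrete _ _ i∼j)) id (∼-trans Y)

⊓-discrete : ∀ X Y → discrete ⊑ X → discrete ⊑ Y → discrete ⊑ (X ⊓ Y)
⊓-discrete X Y X-discrete Y-discrete _ _ = Join-elim (X-discrete _ _) (Y-discrete _ _) trans

covered⇒¬InfinitelyManyBlocks : ∀ X {k} (reps : Fin k → ℕ) → (∀ n → ∃ λ c → _∼_ X (reps c) n) →
                                ¬ InfinitelyManyBlocks X
covered⇒¬InfinitelyManyBlocks X {k} reps cover infinite with infinite (suc k)
... | f , distinct with Fin.pigeonhole ≤-refl (proj₁ ∘ cover ∘ f)
... | i , j , i<j , same-rep = Fin.<-irrefl (distinct i j f[i]∼f[j]) i<j
  where
  f[i]∼f[j] : _∼_ X (f i) (f j)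
  f[i]∼f[j] = ∼-trans X (∼-sym X (proj₂ (cover (f i))))
                        (subst (λ c → _∼_ X (reps c) (f j)) (sym same-rep) (proj₂ (cover (f j))))

module _ {U} (U-ultra : IsPartitionUltrafilter U) where
  open IsPartitionUltrafilter U-ultra
  private module U = IsPartitionFilter isFilter

  -- U together with the discrete partition still generates a filter, so maximality puts it into U.
  discrete∈U : U discrete
  discrete∈U = maximal F F-filter (λ _ → inj₁) discrete (inj₂ (λ _ _ → id))
    where
    F : Partition → Set
    F Y = U Y ⊎ discrete ⊑ Y

    F-filter : IsPartitionFilter F
    F-filter = record { notOne = notOne ; meet = meet ; upward = upward }
      where
      notOne : ¬ F oneBlock
      notOne (inj₁ one∈U) = U.notOne one∈U
      notOne (inj₂ one-discrete) with () ← one-discrete 0 1 tt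

      meet : ∀ X Y → F X → F Y → F (X ⊓ Y)
      meet X Y (inj₁ X∈U) (inj₁ Y∈U) = inj₁ (U.meet X Y X∈U Y∈U)
      meet X Y (inj₁ X∈U) (inj₂ Y-discrete) = inj₁ (U.upward X (X ⊓ Y) X∈U (⊓-discreteʳ X Y Y-discrete))
      meet X Y (inj₂ X-discrete) (inj₁ Y∈U) = inj₁ (U.upward Y (X ⊓ Y) Y∈U (⊓-discreteˡ X Y X-discrete))
      meet X Y (inj₂ X-discrete) (inj₂ Y-discrete) = inj₂ (⊓-discrete X Y X-discrete Y-discrete)

      upward : ∀ X Y → F X → X ⊑ Y → F Y
      upward X Y (inj₁ X∈U) X⊑Y = inj₁ (U.upward X Y X∈U X⊑Y)
      upward X Y (inj₂ X-discrete) X⊑Y = inj₂ (λ i j i∼j → X-discrete i j (X⊑Y i j i∼j))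

-- Segments

validᵇ-intro : ∀ l → (∀ i → i < length l → l ! i ≤ i × l ! (l ! i) ≡ l ! i) → T (validᵇ l)
validᵇ-intro l valid = go (upTo (length l)) (λ i∈ → valid _ (∈-upTo⁻ i∈))
  where
  go : ∀ is → (∀ {i} → i ∈ is → l ! i ≤ i × l ! (l ! i) ≡ l ! i) →
       T (foldr (λ i b → ((l ! i) ≤ᵇ i) ∧ ((l ! (l ! i)) ≡ᵇ (l ! i)) ∧ b) true is)
  go [] _ = tt
  go (i ∷ is) valid-is =
    let i-below , i-idempotent = valid-is (here refl)
    in Equivalence.from T-∧ (≤⇒≤ᵇ i-below ,
       Equivalence.from T-∧ (≡⇒≡ᵇ _ _ i-idempotent , go is (valid-is ∘ there)))

blockMinima : Segment → List ℕ
blockMinima s = filter (λ i → mins s ! i ≟ i) (upTo (dom s))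

blockMinima-sorted : ∀ s → AllPairs _<_ (blockMinima s)
blockMinima-sorted s = AllPairs.filter⁺ _ (AllPairs.applyUpTo⁺₁ id (dom s) (λ i<j _ → i<j))

-- f i is the least element of the block of i, as in the encoding of segments in Defs.
record MinSelector (f : ℕ → ℕ) : Set where
  field
    below      : ∀ i → f i ≤ i
    idempotent : ∀ i → f (f i) ≡ f i

module _ {f} (sel : MinSelector f) where
  open MinSelector sel

  fixed⇒Min-kernel : ∀ {n} → f n ≡ n → Min (kernel f) n
  fixed⇒Min-kernel fn≡n m m<n fm≡fn = <⇒≱ m<n (subst (_≤ m) (trans fm≡fn fn≡n) (below m))

  Min-kernel⇒fixed : ∀ {n} → Min (kernel f) n → f n ≡ n
  Min-kernel⇒fixed {n} minₙ with m≤n⇒m<n∨m≡n (below n)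
  ... | inj₁ fn<n = contradiction (idempotent n) (minₙ (f n) fn<n)
  ... | inj₂ fn≡n = fn≡n

  segment : ℕ → Segment
  segment n = seg l (validᵇ-intro l λ _ i<len → below-l i<len , idempotent-l i<len)
    where
    l : List ℕ
    l = applyUpTo f n

    l!≡f : ∀ {i} → i < length l → l ! i ≡ f i
    l!≡f i<len = !-applyUpTo f (subst (_ <_) (length-applyUpTo f n) i<len)

    below-l : ∀ {i} → i < length l → l ! i ≤ i
    below-l {i} i<len = subst (_≤ i) (sym (l!≡f i<len)) (below i)

    idempotent-l : ∀ {i} → i < length l → l ! (l ! i) ≡ l ! i
    idempotent-l {i} i<len rewrite l!≡f i<len =
      trans (l!≡f (≤-trans (s≤s (below i)) i<len)) (idempotent i)

  dom-segment : ∀ n → dom (segment n) ≡ n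
  dom-segment = length-applyUpTo f

  segment-! : ∀ {n i} → i < n → mins (segment n) ! i ≡ f i
  segment-! = !-applyUpTo f

  ∈-blockMinima⁻ : ∀ n {z} → z ∈ blockMinima (segment n) → z < n × f z ≡ z
  ∈-blockMinima⁻ n z∈ =
    let z∈upTo , fixed = ∈-filter⁻ (λ i → mins (segment n) ! i ≟ i) {xs = upTo (dom (segment n))} z∈
        z<n = subst (_ <_) (dom-segment n) (∈-upTo⁻ z∈upTo)
    in z<n , trans (sym (segment-! z<n)) fixed

  ∈-blockMinima⁺ : ∀ {n z} → z < n → f z ≡ z → z ∈ blockMinima (segment n)
  ∈-blockMinima⁺ {n} z<n fixed =
    ∈-filter⁺ (λ i → mins (segment n) ! i ≟ i)
      (∈-upTo⁺ (subst (_ <_) (sym (dom-segment n)) z<n)) (trans (segment-! z<n) fixed)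

  star-segment-⊑ : ∀ X {n} → (∀ {i j} → _∼_ X i j → f i ≡ f j) → Min X n → star (segment n) ⊑ᴸ X
  star-segment-⊑ X {n} invariant minₙ i j i<len j<len i∼j =
    i<len , j<len , same-block (split i<len) (split j<len) i∼j
    where
    l : List ℕ
    l = mins (segment n)

    split : ∀ {i} → i < length (l ∷ʳ length l) → i < length l ⊎ i ≡ length l
    split i<len = m<1+n⇒m<n∨m≡n (subst (_ <_) (length-∷ʳ l (length l)) i<len)

    star! : ∀ {i} → i < length l → (l ∷ʳ length l) ! i ≡ f i
    star! i<len = trans (!-++ˡ l _ i<len) (segment-! (subst (_ <_) (dom-segment n) i<len))

    not-top : ∀ {i} → i < length l → ¬ _∼_ X i (length l)
    not-top {i} i<len i∼top =
      minₙ i (subst (i <_) (dom-segment n) i<len) (subst (_∼_ X i) (dom-segment n) i∼top)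

    same-block : ∀ {i j} → i < length l ⊎ i ≡ length l → j < length l ⊎ j ≡ length l →
                 _∼_ X i j → (l ∷ʳ length l) ! i ≡ (l ∷ʳ length l) ! j
    same-block (inj₁ i<len) (inj₁ j<len) i∼j = trans (star! i<len) (trans (invariant i∼j) (sym (star! j<len)))
    same-block (inj₂ refl) (inj₂ refl) _ = refl
    same-block (inj₁ i<len) (inj₂ refl) i∼j = contradiction i∼j (not-top i<len)
    same-block (inj₂ refl) (inj₁ j<len) i∼j = contradiction (∼-sym X i∼j) (not-top j<len)

module GreatestSelector {Q : ℕ → ℕ → Set} (Q? : ∀ n m → Dec (Q n m)) (witness : ∀ n → ∃ λ m → m ≤ n × Q n m)
                        (diagonal : ∀ {n m} → Q n m → Q m m) where

  private
    spec : ∀ n → Σ ℕ λ g → g ≤ n × Q n g × (∀ {m} → m ≤ n → Q n m → m ≤ g)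
    spec n = let m , m≤n , Qm = witness n in greatest-≤ (Q? n) n m≤n Qm

  select : ℕ → ℕ
  select n = proj₁ (spec n)

  select-≤ : ∀ n → select n ≤ n
  select-≤ n = proj₁ (proj₂ (spec n))

  select-Q : ∀ n → Q n (select n)
  select-Q n = proj₁ (proj₂ (proj₂ (spec n)))

  select-maximal : ∀ {n m} → m ≤ n → Q n m → m ≤ select n
  select-maximal {n} = proj₂ (proj₂ (proj₂ (spec n)))

  select-fixed : ∀ {n} → Q n n → select n ≡ n
  select-fixed {n} Qnn = ≤-antisym (select-≤ n) (select-maximal ≤-refl Qnn)

  isMinSelector : MinSelector select
  isMinSelector = record { below = select-≤ ; idempotent = λ n → select-fixed (diagonal (select-Q n)) }

singletonSegment : Segment
singletonSegment = seg (0 ∷ []) tt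

singletonSegment-⊴ : ∀ X → singletonSegment ⊴ X
singletonSegment-⊴ X zero zero (s≤s z≤n) (s≤s z≤n) = (λ _ → ∼-refl X) , (λ _ → s≤s z≤n , s≤s z≤n , refl)

singletonSegment-⊴ˢ : ∀ {u} → 0 < dom u → singletonSegment ⊴ˢ u
singletonSegment-⊴ˢ 0<dom = 0<dom , λ where
  zero zero (s≤s z≤n) (s≤s z≤n) → (λ _ → 0<dom , 0<dom , refl) , (λ _ → s≤s z≤n , s≤s z≤n , refl)

-- u codes the tuple x₁ < ⋯ < xₙ when its block minima are 0, x₁, …, xₙ₋₁ and dom u = xₙ.
Codes : ∀ {n} → Segment → Vec ℕ n → Set
Codes u v = toList (0 ∷ v) ≡ blockMinima u ∷ʳ dom u

Codes⇒∣∣≡ : ∀ {n u} {v : Vec ℕ n} → Codes u v → ∣ u ∣ ≡ n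
Codes⇒∣∣≡ {n} {u} {v} codes = suc-injective (begin
  suc ∣ u ∣                          ≡⟨ length-∷ʳ (blockMinima u) (dom u) ⟨
  length (blockMinima u ∷ʳ dom u)   ≡⟨ cong length codes ⟨
  length (toList (0 ∷ v))           ≡⟨ length-toList (0 ∷ v) ⟩
  suc n                             ∎)
  where open ≡-Reasoning

Codes-unique : ∀ {n u} {v w : Vec ℕ n} → Codes u v → Codes u w → v ≡ w
Codes-unique {v = v} {w} codes-v codes-w =
  ∷-injectiveʳ (trans (sym (cast-is-id refl (0 ∷ v)))
                      (toList-injective refl (0 ∷ v) (0 ∷ w) (trans codes-v (sym codes-w))))

decColour : {P : Set} → Dec P → Fin 2
decColour (yes _) = zero
decColour (no _) = suc zero

decColour-zero : {P : Set} (d : Dec P) → decColour d ≡ zero → P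
decColour-zero (yes p) _ = p

decColour-one : {P : Set} (d : Dec P) → decColour d ≡ suc zero → ¬ P
decColour-one (no ¬p) _ = ¬p

-- Block minima of a Ramseyan ultrafilter

IsZero : Subset
IsZero n = n ≡ 0

module Classical (em : ExcludedMiddle 0ℓ) where

  blockMin : ∀ X n → ∃ λ m → m ≤ n × _∼_ X m n × Min X m
  blockMin X = <-rec _ go
    where
    go : ∀ n → (∀ {m} → m < n → ∃ λ b → b ≤ m × _∼_ X b m × Min X b) → ∃ λ b → b ≤ n × _∼_ X b n × Min X b
    go n below with em {∃ λ m → m < n × _∼_ X m n}
    ... | no none = n , ≤-refl , ∼-refl X , λ m m<n m∼n → none (m , m<n , m∼n)
    ... | yes (m , m<n , m∼n) =
      let b , b≤m , b∼m , min-b = below m<n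
      in b , ≤-trans b≤m (<⇒≤ m<n) , ∼-trans X b∼m m∼n , min-b

  constant-value : {A B : Set} → B → (f : A → B) → (∀ a a′ → f a ≡ f a′) → Σ B λ b → ∀ a → f a ≡ b
  constant-value {A} default f constant with em {A}
  ... | yes a = f a , λ a′ → constant a′ a
  ... | no ¬a = default , λ a → contradiction a ¬a

  refine : ∀ X (C : Subset) → Min X ⊆ C → Σ Partition λ Y → X ⊑ Y × Min Y ⊆ C × C ⊆ Min Y
  refine X C Min⊆C = kernel select , X⊑Y , Min⊆ , ⊆Min
    where
    Q : ℕ → ℕ → Set
    Q n m = _∼_ X m n × C m

    witness : ∀ n → ∃ λ m → m ≤ n × Q n m
    witness n = let b , b≤n , b∼n , min-b = blockMin X n in b , b≤n , b∼n , Min⊆C b min-b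

    open GreatestSelector {Q} (λ _ _ → em) witness (λ (_ , Cm) → ∼-refl X , Cm)

    X⊑Y : X ⊑ kernel select
    X⊑Y i j same = ∼-trans X (∼-sym X (proj₁ (select-Q i)))
                             (subst (λ m → _∼_ X m j) (sym same) (proj₁ (select-Q j)))

    Min⊆ : Min (kernel select) ⊆ C
    Min⊆ n minₙ = subst C (Min-kernel⇒fixed isMinSelector minₙ) (proj₂ (select-Q n))

    ⊆Min : C ⊆ Min (kernel select)
    ⊆Min n Cn = fixed⇒Min-kernel isMinSelector (select-fixed (∼-refl X , Cn))

  -- The coarsening of X to a segment of domain top whose block minima are 0 ∷ cs:
  -- each i goes to the largest cut point below the minimum of its X-block.
  module CutSegment (X : Partition) (cs : List ℕ) (top : ℕ)
                    (sorted : AllPairs _<_ ((0 ∷ cs) ∷ʳ top)) (minima : L.All (Min X) (cs ∷ʳ top)) where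

    cuts : List ℕ
    cuts = 0 ∷ cs

    LowerBound : ℕ → ℕ → Set
    LowerBound i y = ∀ j → _∼_ X j i → y ≤ j

    Min⇒LowerBound : ∀ {y} → Min X y → LowerBound y y
    Min⇒LowerBound min-y j j∼y = ≮⇒≥ (λ j<y → min-y j j<y j∼y)

    cuts⊆Min : ∀ {z} → z ∈ cuts → Min X z
    cuts⊆Min (here refl) _ ()
    cuts⊆Min (there z∈cs) = L.lookup (Lₚ.++⁻ˡ cs minima) z∈cs

    Cut : ℕ → ℕ → Set
    Cut i y = y ∈ cuts × LowerBound i y

    open GreatestSelector {Cut} (λ _ _ → em) (λ _ → 0 , z≤n , here refl , λ _ _ → z≤n)
                              (λ (y∈cuts , _) → y∈cuts , Min⇒LowerBound (cuts⊆Min y∈cuts))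
      renaming (select to cut)

    cut-≤ : ∀ {i j} → _∼_ X i j → cut i ≤ cut j
    cut-≤ {i} {j} i∼j =
      let cut∈cuts , lower = select-Q i
      in select-maximal (lower j (∼-sym X i∼j)) (cut∈cuts , λ l l∼j → lower l (∼-trans X l∼j (∼-sym X i∼j)))

    cut-invariant : ∀ {i j} → _∼_ X i j → cut i ≡ cut j
    cut-invariant i∼j = ≤-antisym (cut-≤ i∼j) (cut-≤ (∼-sym X i∼j))

    u : Segment
    u = segment isMinSelector top

    cuts<top : L.All (_< top) cuts
    cuts<top = proj₂ (AllPairs-∷ʳ⁻ sorted)

    blockMinima-u : blockMinima u ≡ cuts
    blockMinima-u = AllPairs-<-unique (blockMinima-sorted u) (proj₁ (AllPairs-∷ʳ⁻ sorted)) ⊆cuts cuts⊆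
      where
      ⊆cuts : ∀ {z} → z ∈ blockMinima u → z ∈ cuts
      ⊆cuts {z} z∈ = subst (_∈ cuts) (proj₂ (∈-blockMinima⁻ isMinSelector top z∈)) (proj₁ (select-Q z))

      cuts⊆ : ∀ {z} → z ∈ cuts → z ∈ blockMinima u
      cuts⊆ z∈cuts = ∈-blockMinima⁺ isMinSelector (L.lookup cuts<top z∈cuts)
                       (select-fixed (z∈cuts , Min⇒LowerBound (cuts⊆Min z∈cuts)))

    dom-u : dom u ≡ top
    dom-u = dom-segment isMinSelector top

    star-u-⊑ : star u ⊑ᴸ X
    star-u-⊑ = star-segment-⊑ isMinSelector X cut-invariant (L.head (Lₚ.++⁻ʳ cs minima))

    0<top : 0 < top
    0<top = L.head cuts<top

  codingSegment : ∀ X {k} {v : Vec ℕ (suc k)} → Increasing v → All (Min X ∖ IsZero) v →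
                  Σ Segment λ u → Codes u v × InSX singletonSegment X (suc k) u
  codingSegment X {v = v} increasing v⊆Min with initLast v
  ... | cs , top , refl =
    u , codes , Codes⇒∣∣≡ {u = u} codes , singletonSegment-⊴ˢ {u} (subst (0 <_) (sym dom-u) 0<top) , star-u-⊑
    where
    sorted : AllPairs _<_ (0 ∷ toList v)
    sorted = L.map (n≢0⇒n>0 ∘ proj₂) (Vₚ.toList⁺ v⊆Min) ∷ Linked⇒AllPairs <-trans (Increasing⇒Linked increasing)

    minima : L.All (Min X) (toList v)
    minima = L.map proj₁ (Vₚ.toList⁺ v⊆Min)

    open CutSegment X (toList cs) top (subst (AllPairs _<_ ∘ (0 ∷_)) (toList-∷ʳ top cs) sorted)
                                      (subst (L.All (Min X)) (toList-∷ʳ top cs) minima)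

    codes : Codes u v
    codes = trans (cong (0 ∷_) (toList-∷ʳ top cs)) (sym (cong₂ _∷ʳ_ blockMinima-u dom-u))

  Min∖0⊆[a]⇒¬InfinitelyManyBlocks : ∀ X a → (Min X ∖ IsZero) ⊆ (_≡ a) → ¬ InfinitelyManyBlocks X
  Min∖0⊆[a]⇒¬InfinitelyManyBlocks X a Min∖0⊆[a] = covered⇒¬InfinitelyManyBlocks X (lookup (0 ∷ a ∷ [])) cover
    where
    cover : ∀ n → ∃ λ c → _∼_ X (lookup (0 ∷ a ∷ []) c) n
    cover n with blockMin X n
    ... | m , _ , m∼n , min-m with m ≟ 0
    ...   | yes refl = zero , m∼n
    ...   | no m≢0 with refl ← Min∖0⊆[a] m (min-m , m≢0) = suc zero , m∼n

  module _ {k r} (c : (v : Vec ℕ (suc k)) → Increasing v → All ω∖0 v → Fin (suc r)) where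

    CodedTuple : Segment → Set
    CodedTuple u = Σ (Vec ℕ (suc k)) λ v → Increasing v × All ω∖0 v × Codes u v

    colourOf : ∀ u → Dec (CodedTuple u) → Fin (suc r)
    colourOf _ (yes (v , increasing , positive , _)) = c v increasing positive
    colourOf _ (no _) = zero

    segmentColouring : (u : Segment) → suc k ≤ ∣ u ∣ → Fin (suc r)
    segmentColouring u _ = colourOf u em

    segmentColouring-Codes : ∀ u {v} (increasing : Increasing v) (positive : All ω∖0 v) (p : suc k ≤ ∣ u ∣) →
                             Codes u v → segmentColouring u p ≡ c v increasing positive
    segmentColouring-Codes u {v} increasing positive _ codes = colourOf-Codes em
      where
      colourOf-Codes : (d : Dec (CodedTuple u)) → colourOf u d ≡ c v increasing positive
      colourOf-Codes (yes (w , increasing′ , positive′ , codes′)) with refl ← Codes-unique {u = u} codes′ codes =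
        cong₂ (c v) (Increasing-irrelevant increasing′ increasing) (V.irrelevant <-irrelevant positive′ positive)
      colourOf-Codes (no none) = contradiction (v , increasing , positive , codes) none

  module RamseyanMinImage {U} (U-ramseyan : IsRamseyanUltrafilter U) where
    open IsRamseyanUltrafilter U-ramseyan
    private module U = IsPartitionFilter (IsPartitionUltrafilter.isFilter ultrafilter)

    Image : Subset → Set₁
    Image = MinImage U

    Image⊆ω∖0 : ∀ B → Image B → B ⊆ ω∖0
    Image⊆ω∖0 B (_ , _ , B⊆ , _) n Bn = n≢0⇒n>0 (proj₂ (B⊆ n Bn))

    Image-intro : ∀ {X B} → U X → (Min X ∖ IsZero) ⊆ B → B ⊆ ω∖0 → Image B
    Image-intro {X} {B} X∈U Min∖0⊆B B⊆ω∖0 with refine X (λ n → B n ⊎ n ≡ 0) Min⊆B∪0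
      where
      Min⊆B∪0 : Min X ⊆ (λ n → B n ⊎ n ≡ 0)
      Min⊆B∪0 n minₙ with n ≟ 0
      ... | yes n≡0 = inj₂ n≡0
      ... | no n≢0 = inj₁ (Min∖0⊆B n (minₙ , n≢0))
    ... | Y , X⊑Y , MinY⊆ , ⊆MinY = Y , U.upward X Y X∈U X⊑Y , B⊆MinY∖0 , MinY∖0⊆B
      where
      B⊆MinY∖0 : B ⊆ (Min Y ∖ IsZero)
      B⊆MinY∖0 n Bn = ⊆MinY n (inj₁ Bn) , >⇒≢ (B⊆ω∖0 n Bn)

      MinY∖0⊆B : (Min Y ∖ IsZero) ⊆ B
      MinY∖0⊆B n (minₙ , n≢0) with MinY⊆ n minₙ
      ... | inj₁ Bn = Bn
      ... | inj₂ n≡0 = contradiction n≡0 n≢0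

    Image-whole : Image ω∖0
    Image-whole = Image-intro (discrete∈U ultrafilter) (λ n (_ , n≢0) → n≢0⇒n>0 n≢0) (λ _ → id)

    Image-proper : ¬ Image ∅
    Image-proper (X , X∈U , _ , Min∖0⊆∅) =
      Min∖0⊆[a]⇒¬InfinitelyManyBlocks X 0 (λ n p → ⊥-elim (Min∖0⊆∅ n p)) (infinite X X∈U)

    Image-∩ : ∀ B C → Image B → Image C → Image (B ∩ C)
    Image-∩ B C B∈@(X , X∈U , _ , MinX∖0⊆B) (Y , Y∈U , _ , MinY∖0⊆C) =
      Image-intro (U.meet X Y X∈U Y∈U) Min[X⊓Y]∖0⊆B∩C (λ n (Bn , _) → Image⊆ω∖0 B B∈ n Bn)
      where
      Min[X⊓Y]∖0⊆B∩C : (Min (X ⊓ Y) ∖ IsZero) ⊆ (B ∩ C)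
      Min[X⊓Y]∖0⊆B∩C n (minₙ , n≢0) = MinX∖0⊆B n (⊑⇒Min⊆ (X ⊓ Y) X (⊓-⊑ˡ X Y) n minₙ , n≢0)
                                     , MinY∖0⊆C n (⊑⇒Min⊆ (X ⊓ Y) Y (⊓-⊑ʳ X Y) n minₙ , n≢0)

    Image-upward : ∀ B C → Image B → B ⊆ C → C ⊆ ω∖0 → Image C
    Image-upward B C (X , X∈U , _ , MinX∖0⊆B) B⊆C = Image-intro X∈U (λ n p → B⊆C n (MinX∖0⊆B n p))

    Image-nonPrincipal : ¬ (Σ ℕ λ a → ω∖0 a × (∀ B → B ⊆ ω∖0 → (Image B → B a) × (B a → Image B)))
    Image-nonPrincipal (a , 0<a , principal)
      with proj₂ (principal (_≡ a) (λ { n refl → 0<a })) refl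
    ... | X , X∈U , _ , Min∖0⊆[a] = Min∖0⊆[a]⇒¬InfinitelyManyBlocks X a Min∖0⊆[a] (infinite X X∈U)

    Image-ramsey : ∀ n r → 0 < n → 0 < r → (c : (v : Vec ℕ n) → Increasing v → All ω∖0 v → Fin r) →
                   Σ Subset λ H → Image H × Σ (Fin r) λ colour →
                     ∀ v (p : Increasing v) (q : All ω∖0 v) → All H v → c v p q ≡ colour
    Image-ramsey (suc k) (suc r) _ _ c with coloring r k (segmentColouring c) discrete (discrete∈U ultrafilter)
    ... | X , X∈U , _ , homogeneous =
      let colour , constant = constant-value zero tupleColour sameColour
      in H , (X , X∈U , (λ _ → id) , (λ _ → id)) , colour ,
         λ v increasing positive v⊆H → constant (v , increasing , positive , v⊆H)
      where
      H : Subset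
      H = Min X ∖ IsZero

      Tuple : Set
      Tuple = Σ (Vec ℕ (suc k)) λ v → Increasing v × All ω∖0 v × All H v

      tupleColour : Tuple → Fin (suc r)
      tupleColour (v , increasing , positive , _) = c v increasing positive

      sameColour : ∀ t t′ → tupleColour t ≡ tupleColour t′
      sameColour (v , increasing , positive , v⊆H) (v′ , increasing′ , positive′ , v′⊆H)
        with codingSegment X increasing v⊆H | codingSegment X increasing′ v′⊆H
      ... | u , codes , u∈ | u′ , codes′ , u′∈ = begin
        c v increasing positive     ≡⟨ segmentColouring-Codes c u increasing positive p codes ⟨
        segmentColouring c u p      ≡⟨ homogeneous 0 singletonSegment (singletonSegment-⊴ X) refl u u′ p p′ u∈ u′∈ ⟩
        segmentColouring c u′ p′    ≡⟨ segmentColouring-Codes c u′ increasing′ positive′ p′ codes′ ⟩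
        c v′ increasing′ positive′  ∎
        where
        open ≡-Reasoning
        p = ≤-reflexive (sym (proj₁ u∈))
        p′ = ≤-reflexive (sym (proj₁ u′∈))

    Image-ultra : ∀ B → B ⊆ ω∖0 → Image B ⊎ Image (ω∖0 ∖ B)
    Image-ultra B B⊆ω∖0 with Image-ramsey 1 2 (s≤s z≤n) (s≤s z≤n) (λ { (x ∷ []) _ _ → decColour (em {B x}) })
    ... | H , H∈ , colour , constant =
      side colour λ x x∈H → constant (x ∷ []) tt (Image⊆ω∖0 H H∈ x x∈H ∷ []) (x∈H ∷ [])
      where
      side : ∀ colour → (∀ x → H x → decColour (em {B x}) ≡ colour) → Image B ⊎ Image (ω∖0 ∖ B)
      side zero H-coloured =
        inj₁ (Image-upward H B H∈ (λ x x∈H → decColour-zero em (H-coloured x x∈H)) B⊆ω∖0)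
      side (suc zero) H-coloured =
        inj₂ (Image-upward H (ω∖0 ∖ B) H∈
               (λ x x∈H → Image⊆ω∖0 H H∈ x x∈H , decColour-one em (H-coloured x x∈H)) (λ _ → proj₁))

lemma2p6 : ExcludedMiddle (lsuc (lsuc 0ℓ)) →
    (U : Partition → Set) → IsRamseyanUltrafilter U →
    IsRamseyUltrafilterOver ω∖0 (MinImage U)
lemma2p6 em U U-ramseyan = record
  { subsets      = Image⊆ω∖0
  ; whole        = Image-whole
  ; proper       = Image-proper
  ; inter        = Image-∩
  ; upward       = Image-upward
  ; ultra        = Image-ultra
  ; nonPrincipal = Image-nonPrincipal
  ; ramsey       = Image-ramsey
  }
  where open Classical.RamseyanMinImage (lower-em (lsuc (lsuc 0ℓ)) em) U-ramseyan
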